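{- Let $x\in V_k$ and let $G\subseteq T_x$ be a subgraph with $|E(G)|\le 2^k-1$ and $\partial(G)\le k/6$. Then there exists a vertex $z\in V_{k-\partial(G)}\cap V(T_x)$ such that $E(G)\cap E(T_z^+)=\emptyset$.
   Context: $T_\infty$ is the infinite tree whose vertex set is partitioned into levels $V_0,V_1,\dots$ such that each vertex of $V_j$ has exactly one neighbor in $V_{j+1}$ (its parent), each vertex of $V_j$ with $j\ge1$ has exactly two neighbors in $V_{j-1}$ (its children), there are no other edges, and any two vertices have a common ancestor; $V_0$ is the set of leaves. For $x\in V_k$, $T_x$ is the complete binary tree of height $k$ consisting of $x$ and its descendants, and $T_x^+$ is $T_x$ together with the edge joining $x$ to its parent. Subgraphs have no isolated vertices. $\partial(G)$ is the number of vertices of $G$ incident to at least one edge of $T_\infty$ not in $E(G)$. -}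

module Defs where

open import Data.Bool using (Bool; true; false; not; _∧_; _∨_)
open import Data.Nat using (ℕ; zero; suc; _≤ᵇ_)
open import Data.List using (List; []; _∷_; length; concatMap; map; upTo; filterᵇ; null)

-- A vertex of T_x is encoded by its address:
-- the list of left/right choices on the path from x down to it, written
-- with the LAST step at the head.  So the address s has level k ∸ length s,
-- x has address [], the children of s are (false ∷ s) and (true ∷ s),
-- and the descendants of z are exactly the addresses t ++ z.
-- An edge of T_∞ between a vertex and its parent is named by the lower
-- endpoint.  Every edge of T_∞ incident to a vertex of T_x is either an edge
-- of T_x (named by a nonempty address of length ≤ k) or the edge joining x
-- to its parent (named by []).

strs : ℕ → List (List Bool)
strs zero    = [] ∷ []
strs (suc n) = concatMap (λ s → (false ∷ s) ∷ (true ∷ s) ∷ []) (strs n)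

vertsT : ℕ → List (List Bool)
vertsT k = concatMap strs (upTo (suc k))

edgesT : ℕ → List (List Bool)
edgesT k = concatMap strs (map suc (upTo k))

isEdgeT : ℕ → List Bool → Bool
isEdgeT k s = not (null s) ∧ (length s ≤ᵇ k)

-- A subgraph G ⊆ T_x (without isolated vertices) is given by its edge set,
-- a characteristic function E; only its values on edges of T_x matter.
inEG : ℕ → (List Bool → Bool) → List Bool → Bool
inEG k E s = isEdgeT k s ∧ E s

numEdges : ℕ → (List Bool → Bool) → ℕ
numEdges k E = length (filterᵇ E (edgesT k))

inVG : ℕ → (List Bool → Bool) → List Bool → Bool
inVG k E v = inEG k E v ∨ inEG k E (false ∷ v) ∨ inEG k E (true ∷ v)

-- v ∈ V(G) is incident to an edge of T_∞ not in E(G):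
-- its parent edge (always exists) is not in G, or a child edge
-- (exists iff it is an edge of T_x) is not in G.
isBoundary : ℕ → (List Bool → Bool) → List Bool → Bool
isBoundary k E v =
  inVG k E v ∧
  (not (inEG k E v)
   ∨ (isEdgeT k (false ∷ v) ∧ not (inEG k E (false ∷ v)))
   ∨ (isEdgeT k (true ∷ v) ∧ not (inEG k E (true ∷ v))))

bdry : ℕ → (List Bool → Bool) → ℕ
bdry k E = length (filterᵇ (isBoundary k E) (vertsT k))

module Submission where

-- Let z be a vertex of T_x of height a, and I = 2 ^ (a + 1) − 2 the number of edges of T_z.
-- Either T_z^+ meets no edge of G, or T_z contains a boundary vertex of G and T_z^+ an edge
-- of G, or all of T_z^+ lies in G (an edge of G can only stop at a boundary vertex).
-- In the last two cases |E(G) ∩ E(T_z^+)| + I · #(boundary vertices in T_z) ≥ I + 1.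
-- If no T_z^+ at depth j = ∂(G) were empty, summing over these 2 ^ j disjoint subtrees
-- would give 2 ^ j (I + 1) ≤ |E(G)| + I j < 2 ^ k + I j, which fails because 2 j ≤ 2 ^ j.
-- Only ∂(G) ≤ k is needed from the hypothesis 6 ∂(G) ≤ k.

open import Defs
open import Algebra.Properties.CommutativeSemigroup as CommSemigroupProperties using ()
open import Data.Bool using (Bool; true; false; not; _∧_; _∨_; T)
open import Data.Bool.Properties using (T-≡)
open import Data.Empty using (⊥-elim)
open import Data.List using (List; []; _∷_; length; _++_; [_]; _∷ʳ_; map; concatMap; upTo; filterᵇ)
open import Data.List.Properties using (++-assoc; ++-identityʳ; length-++; length-++-≤ʳ; map-++; map-cong; map-upTo; concatMap-++; upTo-∷ʳ)
open import Data.List.Reverse using (reverseView; []; _∶_∶ʳ_)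
open import Data.Nat using (ℕ; zero; suc; _+_; _*_; _^_; _∸_; _≤_; _<_; z≤n; s≤s; _≤ᵇ_)
open import Data.Nat.ListAction using (sum)
open import Data.Nat.ListAction.Properties using (sum-++)
open import Data.Nat.Properties
open import Data.Nat.Tactic.RingSolver using (solve-∀)
open import Data.Product using (Σ; _×_; _,_)
open import Data.Sum using (_⊎_; inj₁; inj₂)
open import Function using (_∘_; Equivalence)
open import Relation.Binary.PropositionalEquality hiding ([_])
open import Relation.Nullary using (¬_; contradiction)

open CommSemigroupProperties +-commutativeSemigroup using (interchange)

ind : Bool → ℕ
ind true  = 1
ind false = 0

ind-∧ʳ : ∀ b c → ind (b ∧ c) ≤ ind c
ind-∧ʳ true  c = ≤-refl
ind-∧ʳ false c = z≤n

length-filterᵇ : {A : Set} (p : A → Bool) (xs : List A) →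
  length (filterᵇ p xs) ≡ sum (map (ind ∘ p) xs)
length-filterᵇ p []       = refl
length-filterᵇ p (x ∷ xs) with p x
... | true  = cong suc (length-filterᵇ p xs)
... | false = length-filterᵇ p xs

sum-map-+ : {A : Set} (f g : A → ℕ) (xs : List A) →
  sum (map (λ x → f x + g x) xs) ≡ sum (map f xs) + sum (map g xs)
sum-map-+ f g []       = refl
sum-map-+ f g (x ∷ xs) = trans (cong (f x + g x +_) (sum-map-+ f g xs))
                               (interchange (f x) (g x) _ _)

sum-map-mono-≤ : {A : Set} {f g : A → ℕ} → (∀ x → f x ≤ g x) →
  (xs : List A) → sum (map f xs) ≤ sum (map g xs)
sum-map-mono-≤ f≤g []       = z≤n
sum-map-mono-≤ f≤g (x ∷ xs) = +-mono-≤ (f≤g x) (sum-map-mono-≤ f≤g xs)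

sum-map-children : (f : List Bool → ℕ) (xs : List (List Bool)) →
  sum (map f (concatMap (λ s → (false ∷ s) ∷ (true ∷ s) ∷ []) xs))
    ≡ sum (map (λ s → f (false ∷ s) + f (true ∷ s)) xs)
sum-map-children f []       = refl
sum-map-children f (s ∷ xs) = trans (cong (λ r → f (false ∷ s) + (f (true ∷ s) + r))
                                          (sum-map-children f xs))
                                    (sym (+-assoc (f (false ∷ s)) (f (true ∷ s)) _))

-- strs extends addresses at the head, i.e. away from x; this moves the new step next to x.
sum-strs-suc : (n : ℕ) (f : List Bool → ℕ) →
  sum (map f (strs (suc n))) ≡ sum (map (λ s → f (s ∷ʳ false) + f (s ∷ʳ true)) (strs n))
sum-strs-suc zero    f = sym (+-assoc (f [ false ]) (f [ true ]) 0)
sum-strs-suc (suc n) f = begin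
  sum (map f (strs (suc (suc n))))
    ≡⟨ sum-map-children f (strs (suc n)) ⟩
  sum (map siblings (strs (suc n)))
    ≡⟨ sum-strs-suc n siblings ⟩
  sum (map (λ u → siblings (u ∷ʳ false) + siblings (u ∷ʳ true)) (strs n))
    ≡⟨ cong sum (map-cong (λ u → interchange (f (false ∷ u ∷ʳ false)) (f (true ∷ u ∷ʳ false))
                                             (f (false ∷ u ∷ʳ true)) (f (true ∷ u ∷ʳ true)))
                          (strs n)) ⟩
  sum (map (λ u → lastSteps (false ∷ u) + lastSteps (true ∷ u)) (strs n))
    ≡⟨ sym (sum-map-children lastSteps (strs n)) ⟩
  sum (map lastSteps (strs (suc n))) ∎
  where
    open ≡-Reasoning
    siblings lastSteps : List Bool → ℕ
    siblings  s = f (false ∷ s) + f (true ∷ s)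
    lastSteps s = f (s ∷ʳ false) + f (s ∷ʳ true)

levelSum : (List Bool → ℕ) → ℕ → List Bool → ℕ
levelSum g n v = sum (map (λ s → g (s ++ v)) (strs n))

levelSum-suc : (g : List Bool → ℕ) (n : ℕ) (v : List Bool) →
  levelSum g (suc n) v ≡ levelSum g n (false ∷ v) + levelSum g n (true ∷ v)
levelSum-suc g n v = begin
  levelSum g (suc n) v
    ≡⟨ sum-strs-suc n (λ s → g (s ++ v)) ⟩
  sum (map (λ s → g ((s ∷ʳ false) ++ v) + g ((s ∷ʳ true) ++ v)) (strs n))
    ≡⟨ cong sum (map-cong (λ s → cong₂ _+_ (cong g (++-assoc s [ false ] v))
                                           (cong g (++-assoc s [ true ] v)))
                          (strs n)) ⟩
  sum (map (λ s → g (s ++ false ∷ v) + g (s ++ true ∷ v)) (strs n))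
    ≡⟨ sum-map-+ (λ s → g (s ++ false ∷ v)) (λ s → g (s ++ true ∷ v)) (strs n) ⟩
  levelSum g n (false ∷ v) + levelSum g n (true ∷ v) ∎
  where open ≡-Reasoning

treeSum : (List Bool → ℕ) → ℕ → List Bool → ℕ
treeSum g zero    v = g v
treeSum g (suc h) v = g v + (treeSum g h (false ∷ v) + treeSum g h (true ∷ v))

treeSum-root : (g : List Bool → ℕ) (h : ℕ) (v : List Bool) → g v ≤ treeSum g h v
treeSum-root g zero    v = ≤-refl
treeSum-root g (suc h) v = m≤m+n (g v) _

treeSum-root-true : (p : List Bool → Bool) (h : ℕ) (v : List Bool) → p v ≡ true →
  1 ≤ treeSum (ind ∘ p) h v
treeSum-root-true p h v pv = ≤-trans (≤-reflexive (cong ind (sym pv))) (treeSum-root (ind ∘ p) h v)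

treeSum-child : (g : List Bool → ℕ) (h : ℕ) (b : Bool) (v : List Bool) →
  treeSum g h (b ∷ v) ≤ treeSum g (suc h) v
treeSum-child g h false v = ≤-trans (m≤m+n _ (treeSum g h (true ∷ v))) (m≤n+m _ (g v))
treeSum-child g h true  v = ≤-trans (m≤n+m _ (treeSum g h (false ∷ v))) (m≤n+m _ (g v))

treeSum-suc : (g : List Bool → ℕ) (h : ℕ) (v : List Bool) →
  treeSum g (suc h) v ≡ treeSum g h v + levelSum g (suc h) v
treeSum-suc g zero    v = cong (g v +_) (cong (g (false ∷ v) +_) (sym (+-identityʳ _)))
treeSum-suc g (suc h) v = begin
  g v + (treeSum g (suc h) (false ∷ v) + treeSum g (suc h) (true ∷ v))
    ≡⟨ cong (g v +_) (cong₂ _+_ (treeSum-suc g h (false ∷ v)) (treeSum-suc g h (true ∷ v))) ⟩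
  g v + ((treeSum g h (false ∷ v) + levelSum g (suc h) (false ∷ v))
         + (treeSum g h (true ∷ v) + levelSum g (suc h) (true ∷ v)))
    ≡⟨ cong (g v +_) (interchange (treeSum g h (false ∷ v)) (levelSum g (suc h) (false ∷ v))
                                 (treeSum g h (true ∷ v)) (levelSum g (suc h) (true ∷ v))) ⟩
  g v + ((treeSum g h (false ∷ v) + treeSum g h (true ∷ v))
         + (levelSum g (suc h) (false ∷ v) + levelSum g (suc h) (true ∷ v)))
    ≡⟨ sym (+-assoc (g v) _ _) ⟩
  treeSum g (suc h) v + (levelSum g (suc h) (false ∷ v) + levelSum g (suc h) (true ∷ v))
    ≡⟨ cong (treeSum g (suc h) v +_) (sym (levelSum-suc g (suc h) v)) ⟩
  treeSum g (suc h) v + levelSum g (suc (suc h)) v ∎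
  where open ≡-Reasoning

sum-vertsT : (g : List Bool → ℕ) (h : ℕ) → sum (map g (vertsT h)) ≡ treeSum g h []
sum-vertsT g zero    = +-identityʳ (g [])
sum-vertsT g (suc h) = begin
  sum (map g (concatMap strs (upTo (suc (suc h)))))
    ≡⟨ cong (λ ns → sum (map g (concatMap strs ns))) (sym (upTo-∷ʳ (suc h))) ⟩
  sum (map g (concatMap strs (upTo (suc h) ++ [ suc h ])))
    ≡⟨ cong (sum ∘ map g) (concatMap-++ strs (upTo (suc h)) [ suc h ]) ⟩
  sum (map g (vertsT h ++ (strs (suc h) ++ [])))
    ≡⟨ cong (sum ∘ map g) (cong (vertsT h ++_) (++-identityʳ (strs (suc h)))) ⟩
  sum (map g (vertsT h ++ strs (suc h)))
    ≡⟨ cong sum (map-++ g (vertsT h) (strs (suc h))) ⟩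
  sum (map g (vertsT h) ++ map g (strs (suc h)))
    ≡⟨ sum-++ (map g (vertsT h)) (map g (strs (suc h))) ⟩
  sum (map g (vertsT h)) + sum (map g (strs (suc h)))
    ≡⟨ cong₂ _+_ (sum-vertsT g h)
                 (cong sum (map-cong (λ s → cong g (sym (++-identityʳ s))) (strs (suc h)))) ⟩
  treeSum g h [] + levelSum g (suc h) []
    ≡⟨ sym (treeSum-suc g h []) ⟩
  treeSum g (suc h) [] ∎
  where open ≡-Reasoning

count-vertsT : (p : List Bool → Bool) (h : ℕ) →
  length (filterᵇ p (vertsT h)) ≡ treeSum (ind ∘ p) h []
count-vertsT p h = trans (length-filterᵇ p (vertsT h)) (sum-vertsT (ind ∘ p) h)

vertsT≡root∷edgesT : (k : ℕ) → vertsT k ≡ [] ∷ edgesT k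
vertsT≡root∷edgesT k = cong (λ ns → [] ∷ concatMap strs ns) (sym (map-upTo suc k))

treeSum-edges≤numEdges : (k : ℕ) (E : List Bool → Bool) →
  treeSum (ind ∘ inEG k E) k [] ≤ numEdges k E
treeSum-edges≤numEdges k E = begin
  treeSum (ind ∘ inEG k E) k []
    ≡⟨ sym (sum-vertsT (ind ∘ inEG k E) k) ⟩
  sum (map (ind ∘ inEG k E) (vertsT k))
    ≡⟨ cong (sum ∘ map (ind ∘ inEG k E)) (vertsT≡root∷edgesT k) ⟩
  sum (map (ind ∘ inEG k E) (edgesT k))
    ≤⟨ sum-map-mono-≤ (λ s → ind-∧ʳ (isEdgeT k s) (E s)) (edgesT k) ⟩
  sum (map (ind ∘ E) (edgesT k))
    ≡⟨ sym (length-filterᵇ E (edgesT k)) ⟩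
  numEdges k E ∎
  where open ≤-Reasoning

frontierSum : (List Bool → ℕ) → ℕ → List Bool → ℕ
frontierSum f zero    v = f v
frontierSum f (suc j) v = frontierSum f j (false ∷ v) + frontierSum f j (true ∷ v)

frontierSum-treeSum≤ : (g : List Bool → ℕ) (j a : ℕ) (v : List Bool) →
  frontierSum (treeSum g a) j v ≤ treeSum g (j + a) v
frontierSum-treeSum≤ g zero    a v = ≤-refl
frontierSum-treeSum≤ g (suc j) a v =
  ≤-trans (+-mono-≤ (frontierSum-treeSum≤ g j a (false ∷ v)) (frontierSum-treeSum≤ g j a (true ∷ v)))
          (m≤n+m _ (g v))

completeTreeEdges : ℕ → ℕ
completeTreeEdges zero    = 0
completeTreeEdges (suc a) = suc (completeTreeEdges a) + suc (completeTreeEdges a)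

2+completeTreeEdges : (a : ℕ) → 2 + completeTreeEdges a ≡ 2 * 2 ^ a
2+completeTreeEdges zero    = refl
2+completeTreeEdges (suc a) = trans (double (completeTreeEdges a)) (cong (2 *_) (2+completeTreeEdges a))
  where
    double : ∀ i → 2 + (suc i + suc i) ≡ 2 * (2 + i)
    double = solve-∀

2*n≤2^n : (n : ℕ) → 2 * n ≤ 2 ^ n
2*n≤2^n zero          = z≤n
2*n≤2^n (suc zero)    = ≤-refl
2*n≤2^n (suc (suc n)) = begin
  2 * suc (suc n)            ≡⟨ *-suc 2 (suc n) ⟩
  2 + 2 * suc n              ≤⟨ +-monoˡ-≤ (2 * suc n) (*-monoʳ-≤ 2 (s≤s z≤n)) ⟩
  2 * suc n + 2 * suc n      ≤⟨ +-mono-≤ (2*n≤2^n (suc n)) (2*n≤2^n (suc n)) ⟩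
  2 ^ suc n + 2 ^ suc n      ≡⟨ cong (2 ^ suc n +_) (sym (+-identityʳ (2 ^ suc n))) ⟩
  2 ^ suc (suc n)            ∎
  where open ≤-Reasoning

frontier-count-impossible : (B P I X Y : ℕ) → 2 + I ≡ 2 * P → X ≤ B → Y < 2 ^ B * P →
  ¬ (2 ^ B * suc I ≤ Y + I * X)
frontier-count-impossible B P I X Y I≡ X≤B Y< heavy = <-irrefl refl (begin-strict
  2 * (Q * suc I)        ≤⟨ *-monoʳ-≤ 2 heavy ⟩
  2 * (Y + I * X)        ≡⟨ *-distribˡ-+ 2 Y (I * X) ⟩
  2 * Y + 2 * (I * X)    <⟨ +-mono-<-≤ (*-monoʳ-< 2 Y<) defects≤ ⟩
  2 * (Q * P) + I * Q    ≡⟨ regroup Q P I ⟩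
  Q * (2 * P) + Q * I    ≡⟨ cong (λ m → Q * m + Q * I) (sym I≡) ⟩
  Q * (2 + I) + Q * I    ≡⟨ ungroup Q I ⟩
  2 * (Q * suc I)        ∎)
  where
    open ≤-Reasoning
    Q = 2 ^ B
    shift : ∀ i x → 2 * (i * x) ≡ i * (2 * x)
    shift = solve-∀
    defects≤ : 2 * (I * X) ≤ I * Q
    defects≤ = ≤-trans (≤-reflexive (shift I X))
                       (*-monoʳ-≤ I (≤-trans (*-monoʳ-≤ 2 X≤B) (2*n≤2^n B)))
    regroup : ∀ q p i → 2 * (q * p) + i * q ≡ q * (2 * p) + q * i
    regroup = solve-∀
    ungroup : ∀ q i → q * (2 + i) + q * i ≡ 2 * (q * suc i)
    ungroup = solve-∀

≤ᵇ-false : {m n : ℕ} → n < m → (m ≤ᵇ n) ≡ false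
≤ᵇ-false {m} {n} n<m with m ≤ᵇ n in eq
... | false = refl
... | true  = contradiction (≤ᵇ⇒≤ m n (subst T (sym eq) _)) (<⇒≱ n<m)

isEdgeT-child : (k : ℕ) (b : Bool) (z : List Bool) → length z < k → isEdgeT k (b ∷ z) ≡ true
isEdgeT-child k b z z<k = Equivalence.to T-≡ (≤⇒≤ᵇ z<k)

isEdgeT-long : (k : ℕ) (s : List Bool) → k < length s → isEdgeT k s ≡ false
isEdgeT-long k (b ∷ s) k<s = ≤ᵇ-false k<s

Free : ℕ → (List Bool → Bool) → List Bool → Set
Free k E z = (t : List Bool) → inEG k E (t ++ z) ≡ false

mixed : Bool → Bool → Bool → Bool
mixed p q r = (p ∨ q ∨ r) ∧ (not p ∨ not q ∨ not r)

mixed-children : (p q r : Bool) → q ≡ not r → mixed p q r ≡ true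
mixed-children true  _ true  refl = refl
mixed-children true  _ false refl = refl
mixed-children false _ true  refl = refl
mixed-children false _ false refl = refl

mixed-parent : (p q r : Bool) → p ≡ not q → mixed p q r ≡ true
mixed-parent _ true  true  refl = refl
mixed-parent _ true  false refl = refl
mixed-parent _ false true  refl = refl
mixed-parent _ false false refl = refl

module _ (k : ℕ) (E : List Bool → Bool) where

  free-leaf : {z : List Bool} → length z ≡ k → inEG k E z ≡ false → Free k E z
  free-leaf     z≡k p []      = p
  free-leaf {z} z≡k p (b ∷ t) = cong (_∧ E (b ∷ t ++ z)) (isEdgeT-long k (b ∷ t ++ z) k<)
    where
      k< : k < length (b ∷ t ++ z)
      k< = s≤s (subst (_≤ length (t ++ z)) z≡k (length-++-≤ʳ z {t}))

  free-node : {z : List Bool} → inEG k E z ≡ false →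
    Free k E (false ∷ z) → Free k E (true ∷ z) → Free k E z
  free-node {z} p f₀ f₁ t with reverseView t
  ... | []            = p
  ... | u ∶ _ ∶ʳ false = trans (cong (inEG k E) (++-assoc u [ false ] z)) (f₀ u)
  ... | u ∶ _ ∶ʳ true  = trans (cong (inEG k E) (++-assoc u [ true ] z)) (f₁ u)

  isBoundary-inner : {z : List Bool} → length z < k →
    isBoundary k E z ≡ mixed (inEG k E z) (inEG k E (false ∷ z)) (inEG k E (true ∷ z))
  isBoundary-inner {z} z<k
    with isEdgeT k (false ∷ z) | isEdgeT-child k false z z<k
       | isEdgeT k (true ∷ z)  | isEdgeT-child k true z z<k
  ... | .true | refl | .true | refl = refl

  edgesIn : ℕ → List Bool → ℕ
  edgesIn = treeSum (ind ∘ inEG k E)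

  boundaryIn : ℕ → List Bool → ℕ
  boundaryIn = treeSum (ind ∘ isBoundary k E)

  -- Used for z of height a, i.e. length z + a ≡ k.
  data Shape (a : ℕ) (z : List Bool) : Set where
    empty  : Free k E z → Shape a z
    broken : 1 ≤ boundaryIn a z → 1 ≤ edgesIn a z → Shape a z
    full   : inEG k E z ≡ true → suc (completeTreeEdges a) ≤ edgesIn a z → Shape a z

  boundary-root : {a : ℕ} {z : List Bool} → length z < k →
    mixed (inEG k E z) (inEG k E (false ∷ z)) (inEG k E (true ∷ z)) ≡ true →
    1 ≤ boundaryIn (suc a) z
  boundary-root {a} {z} z<k m =
    treeSum-root-true (isBoundary k E) (suc a) z (trans (isBoundary-inner {z} z<k) m)

  boundary-by-parent : {a : ℕ} {z : List Bool} → length z < k →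
    inEG k E z ≡ not (inEG k E (false ∷ z)) → 1 ≤ boundaryIn (suc a) z
  boundary-by-parent {a} {z} z<k p≡ =
    boundary-root {a} {z} z<k (mixed-parent _ (inEG k E (false ∷ z)) (inEG k E (true ∷ z)) p≡)

  boundary-by-children : {a : ℕ} {z : List Bool} → length z < k →
    inEG k E (false ∷ z) ≡ not (inEG k E (true ∷ z)) → 1 ≤ boundaryIn (suc a) z
  boundary-by-children {a} {z} z<k q≡ =
    boundary-root {a} {z} z<k (mixed-children (inEG k E z) _ (inEG k E (true ∷ z)) q≡)

  shape-node : {a : ℕ} {z : List Bool} → length z < k →
    Shape a (false ∷ z) → Shape a (true ∷ z) → Shape (suc a) z
  shape-node {a} {z} _ (broken b e) _ = broken (≤-trans b (treeSum-child (ind ∘ isBoundary k E) a false z))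
                                                (≤-trans e (treeSum-child (ind ∘ inEG k E) a false z))
  shape-node {a} {z} _ _ (broken b e) = broken (≤-trans b (treeSum-child (ind ∘ isBoundary k E) a true z))
                                                (≤-trans e (treeSum-child (ind ∘ inEG k E) a true z))
  shape-node {a} {z} z<k (empty f₀) (empty f₁) with inEG k E z in p≡
  ... | true  = broken (boundary-by-parent {a} {z} z<k (trans p≡ (cong not (sym (f₀ [])))))
                       (treeSum-root-true (inEG k E) (suc a) z p≡)
  ... | false = empty (free-node p≡ f₀ f₁)
  shape-node {a} {z} z<k (empty f₀) (full q₁ e₁) =
    broken (boundary-by-children {a} {z} z<k (trans (f₀ []) (cong not (sym q₁))))
           (≤-trans (≤-trans (s≤s z≤n) e₁) (treeSum-child (ind ∘ inEG k E) a true z))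
  shape-node {a} {z} z<k (full q₀ e₀) (empty f₁) =
    broken (boundary-by-children {a} {z} z<k (trans q₀ (cong not (sym (f₁ [])))))
           (≤-trans (≤-trans (s≤s z≤n) e₀) (treeSum-child (ind ∘ inEG k E) a false z))
  shape-node {a} {z} z<k (full q₀ e₀) (full q₁ e₁) with inEG k E z in p≡
  ... | true  = full p≡ (subst (λ b → suc (completeTreeEdges (suc a))
                                         ≤ ind b + (edgesIn a (false ∷ z) + edgesIn a (true ∷ z)))
                               (sym p≡) (s≤s (+-mono-≤ e₀ e₁)))
  ... | false = broken (boundary-by-parent {a} {z} z<k (trans p≡ (cong not (sym q₀))))
                       (≤-trans (≤-trans (s≤s z≤n) e₀) (treeSum-child (ind ∘ inEG k E) a false z))

  shape : (a : ℕ) (z : List Bool) → length z + a ≡ k → Shape a z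
  shape zero z z≡k with inEG k E z in p≡
  ... | true  = full p≡ (treeSum-root-true (inEG k E) zero z p≡)
  ... | false = empty (free-leaf (trans (sym (+-identityʳ _)) z≡k) p≡)
  shape (suc a) z z≡k = shape-node (subst (length z <_) z≡k (m<m+n (length z) (s≤s z≤n)))
                                   (shape a (false ∷ z) child≡k) (shape a (true ∷ z) child≡k)
    where
      child≡k : suc (length z) + a ≡ k
      child≡k = trans (sym (+-suc (length z) a)) z≡k

  shape-bound : {a : ℕ} {z : List Bool} → Shape a z →
    Free k E z ⊎ suc (completeTreeEdges a) ≤ edgesIn a z + completeTreeEdges a * boundaryIn a z
  shape-bound {a} {z} (empty f)    = inj₁ f
  shape-bound {a} {z} (broken b e) = inj₂ (+-mono-≤ e (≤-trans (≤-reflexive (sym (*-identityʳ (completeTreeEdges a))))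
                                                           (*-monoʳ-≤ (completeTreeEdges a) b)))
  shape-bound {a} {z} (full _ e) = inj₂ (≤-trans e (m≤m+n (edgesIn a z) _))

  extend-free : (j : ℕ) (b : Bool) (v : List Bool) →
    Σ (List Bool) (λ t → length t ≡ j × Free k E (t ++ b ∷ v)) →
    Σ (List Bool) (λ t → length t ≡ suc j × Free k E (t ++ v))
  extend-free j b v (t , len , free) =
    t ∷ʳ b , trans (length-++ t) (trans (cong (_+ 1) len) (+-comm j 1))
           , subst (Free k E) (sym (++-assoc t [ b ] v)) free

  frontier : (j a : ℕ) (v : List Bool) → length v + (j + a) ≡ k →
    Σ (List Bool) (λ t → length t ≡ j × Free k E (t ++ v))
    ⊎ 2 ^ j * suc (completeTreeEdges a)
        ≤ frontierSum (edgesIn a) j v + completeTreeEdges a * frontierSum (boundaryIn a) j v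
  frontier zero a v v≡k with shape-bound (shape a v v≡k)
  ... | inj₁ free  = inj₁ ([] , refl , free)
  ... | inj₂ bound = inj₂ (subst (_≤ edgesIn a v + completeTreeEdges a * boundaryIn a v)
                                 (sym (+-identityʳ (suc (completeTreeEdges a)))) bound)
  frontier (suc j) a v v≡k
    with frontier j a (false ∷ v) (trans (sym (+-suc (length v) (j + a))) v≡k)
       | frontier j a (true ∷ v)  (trans (sym (+-suc (length v) (j + a))) v≡k)
  ... | inj₁ w  | _       = inj₁ (extend-free j false v w)
  ... | inj₂ _  | inj₁ w  = inj₁ (extend-free j true v w)
  ... | inj₂ x₀ | inj₂ x₁ = inj₂ (begin
    2 * 2 ^ j * N                                ≡⟨ double (2 ^ j) N ⟩
    2 ^ j * N + 2 ^ j * N                        ≤⟨ +-mono-≤ x₀ x₁ ⟩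
    (Y₀ + I * X₀) + (Y₁ + I * X₁)                ≡⟨ regroup Y₀ Y₁ I X₀ X₁ ⟩
    (Y₀ + Y₁) + I * (X₀ + X₁)                    ∎)
    where
      open ≤-Reasoning
      N = suc (completeTreeEdges a)
      I = completeTreeEdges a
      Y₀ = frontierSum (edgesIn a) j (false ∷ v)
      Y₁ = frontierSum (edgesIn a) j (true ∷ v)
      X₀ = frontierSum (boundaryIn a) j (false ∷ v)
      X₁ = frontierSum (boundaryIn a) j (true ∷ v)
      double : ∀ p n → 2 * p * n ≡ p * n + p * n
      double = solve-∀
      regroup : ∀ y₀ y₁ i x₀ x₁ → (y₀ + i * x₀) + (y₁ + i * x₁) ≡ (y₀ + y₁) + i * (x₀ + x₁)
      regroup = solve-∀

  free-subtree : (j a : ℕ) → j + a ≡ k → bdry k E ≤ j → numEdges k E < 2 ^ k →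
    Σ (List Bool) (λ z → length z ≡ j × Free k E z)
  free-subtree j a j+a≡k ∂≤j few-edges with frontier j a [] j+a≡k
  ... | inj₁ (z , len , free) = z , len , subst (Free k E) (++-identityʳ z) free
  ... | inj₂ heavy = ⊥-elim (frontier-count-impossible j (2 ^ a) (completeTreeEdges a)
                               (frontierSum (boundaryIn a) j []) (frontierSum (edgesIn a) j [])
                               (2+completeTreeEdges a) boundary≤j edges< heavy)
    where
      boundary≤j : frontierSum (boundaryIn a) j [] ≤ j
      boundary≤j = begin
        frontierSum (boundaryIn a) j []                ≤⟨ frontierSum-treeSum≤ (ind ∘ isBoundary k E) j a [] ⟩
        treeSum (ind ∘ isBoundary k E) (j + a) []      ≡⟨ cong (λ h → treeSum (ind ∘ isBoundary k E) h []) j+a≡k ⟩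
        treeSum (ind ∘ isBoundary k E) k []            ≡⟨ sym (count-vertsT (isBoundary k E) k) ⟩
        bdry k E                                       ≤⟨ ∂≤j ⟩
        j                                              ∎
        where open ≤-Reasoning
      edges< : frontierSum (edgesIn a) j [] < 2 ^ j * 2 ^ a
      edges< = begin-strict
        frontierSum (edgesIn a) j []                   ≤⟨ frontierSum-treeSum≤ (ind ∘ inEG k E) j a [] ⟩
        treeSum (ind ∘ inEG k E) (j + a) []            ≡⟨ cong (λ h → treeSum (ind ∘ inEG k E) h []) j+a≡k ⟩
        treeSum (ind ∘ inEG k E) k []                  ≤⟨ treeSum-edges≤numEdges k E ⟩
        numEdges k E                                   <⟨ few-edges ⟩
        2 ^ k                                          ≡⟨ cong (2 ^_) (sym j+a≡k) ⟩
        2 ^ (j + a)                                    ≡⟨ ^-distribˡ-+-* 2 j a ⟩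
        2 ^ j * 2 ^ a                                  ∎
        where open ≤-Reasoning

lemma3p13 : (k : ℕ) (E : List Bool → Bool) →
    numEdges k E ≤ 2 ^ k ∸ 1 →
    6 * bdry k E ≤ k →
    Σ (List Bool) (λ z →
      (length z ≤ k × k ∸ length z ≡ k ∸ bdry k E) ×
      ((t : List Bool) → inEG k E (t ++ z) ≡ false))
lemma3p13 k E edges≤ 6∂≤k =
  let (z , len , free) = free-subtree k E ∂ (k ∸ ∂) (m+[n∸m]≡n ∂≤k) ≤-refl few-edges
  in z , (subst (_≤ k) (sym len) ∂≤k , cong (k ∸_) len) , free
  where
    ∂ = bdry k E
    ∂≤k : ∂ ≤ k
    ∂≤k = ≤-trans (m≤n*m ∂ 6) 6∂≤k
    few-edges : numEdges k E < 2 ^ k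
    few-edges = subst (_≤ 2 ^ k) (+-comm (numEdges k E) 1)
                      (m≤o∸n⇒m+n≤o (numEdges k E) (m^n>0 2 k) edges≤)
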